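{- Let $\mathcal{A}=(V,V_0,V_1,E)$ be an arena, $\mathrm{Cst}$ a cost function and $\Omega$ a coloring, and assume that no vertex of $\mathcal{A}$ has both an incoming increment-edge and an incoming $\epsilon$-edge. Let $I$ be the set of vertices with an incoming increment-edge. Let $\mathcal{G}=(\mathcal{A},\mathrm{BndCostParity}(\Omega,\mathrm{Cst}))$ and $\mathcal{G}'=(\mathcal{A},\mathrm{PCRR}(\Omega,I))$. Then for $i\in\{0,1\}$ and $W\subseteq V$, every finite-state winning strategy for Player $i$ in $\mathcal{G}'$ from $W$ is also a winning strategy for Player $i$ in $\mathcal{G}$ from $W$.
   Context: An arena is a tuple $\mathcal{A}=(V,V_0,V_1,E)$ where $(V,E)$ is a finite directed graph in which every vertex has at least one outgoing edge, and $\{V_0,V_1\}$ is a partition of $V$. A play is an infinite path $\rho=\rho_0\rho_1\cdots$ in $(V,E)$. A game $(\mathcal{A},\mathrm{Win})$ has Player $0$ winning the plays in $\mathrm{Win}\subseteq V^\omega$ and Player $1$ the others. A strategy for Player $i$ is a map $\sigma:V^*V_i\to V$ with $(v,\sigma(wv))\in E$; a play is consistent with $\sigma$ if $\rho_{n+1}=\sigma(\rho_0\cdots\rho_n)$ whenever $\rho_n\in V_i$; it is winning from $W$ if all consistent plays starting in $W$ are won by Player $i$. A memory structure is $\mathcal{M}=(M,\mathrm{Init},\mathrm{Upd})$ with $M$ finite, $\mathrm{Init}:V\to M$, $\mathrm{Upd}:M\times V\to M$, extended by $\mathrm{Upd}^+(\rho_0)=\mathrm{Init}(\rho_0)$, $\mathrm{Upd}^+(wv)=\mathrm{Upd}(\mathrm{Upd}^+(w),v)$;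 with a next-move function $\mathrm{Nxt}:V_i\times M\to V$ (with $(v,\mathrm{Nxt}(v,m))\in E$) it implements $\sigma(\rho_0\cdots\rho_n)=\mathrm{Nxt}(\rho_n,\mathrm{Upd}^+(\rho_0\cdots\rho_n))$; a strategy is finite-state if it is implemented by some memory structure. A cost function is $\mathrm{Cst}:E\to\{\epsilon,i\}$; edges labelled $i$ are increment-edges, those labelled $\epsilon$ are $\epsilon$-edges; the cost $\mathrm{Cst}(w)\in\mathbb{N}\cup\{\infty\}$ of a path is the number of increment-edges it traverses. A coloring is $\Omega:V\to\mathbb{N}$; let $\mathrm{Ans}(c)=\{c'\in\mathbb{N}:c'\ge c,\ c'\text{ even}\}$. For a play $\rho$ and position $k$ let $\mathrm{Cor}(\rho,k)=\min\{\mathrm{Cst}(\rho_k\cdots\rho_{k'}):k'\ge k,\ \Omega(\rho_{k'})\in\mathrm{Ans}(\Omega(\rho_k))\}$ ($\min\emptyset=\infty$); the request at $k$ is answered if this set is nonempty, and unanswered with cost $\infty$ if it is empty and infinitely many increment-edges are traversed after $k$. $\mathrm{Parity}(\Omega)$ is the set of plays whose maximal color seen infinitely often is even. $\mathrm{BndCostParity}(\Omega,\mathrm{Cst})$ is the set of plays with $\limsup_{k\to\infty}\mathrm{Cor}(\rho,k)<\infty$ that contain no request unanswered with cost $\infty$. $\mathrm{coB\ddot{u}chi}(I)$ is the set of plays visiting $I$ only finitely often; $\mathrm{RR}(\Omega)$ is the set of plays in which every request (at every position) is answered; $\mathrm{PCRR}(\Omega,I)=(\mathrm{Parity}(\Omega)\cap\mathrm{coB\ddot{u}chi}(I))\cup\mathrm{RR}(\Omega)$.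 -}

module Defs where

open import Data.Nat using (ℕ; zero; suc; _+_; _*_; _≤_; _<_)
open import Data.Nat.Divisibility using (_∣_)
open import Data.Fin using (Fin)
open import Data.Bool using (Bool; true; false)
open import Data.List using (List; []; _∷_; _++_; [_]; foldl; map; upTo)
open import Data.Product using (Σ; ∃; _×_; _,_)
open import Relation.Binary.PropositionalEquality using (_≡_)
open import Relation.Nullary using (¬_)
open import Data.Sum using (_⊎_)
open import Data.Empty using (⊥)

data Player : Set where
  P0 P1 : Player

record Arena : Set where
  field
    n       : ℕ
    owner   : Fin n → Player
    E       : Fin n → Fin n → Bool
    nonDead : (v : Fin n) → ∃ λ w → E v w ≡ true

  V : Set
  V = Fin n

open Arena public

IsPlay : (A : Arena) → (ℕ → V A) → Set
IsPlay A ρ = (k : ℕ) → E A (ρ k) (ρ (suc k)) ≡ true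

prefix : {X : Set} → (ℕ → X) → ℕ → List X
prefix ρ k = map ρ (upTo k)

-- Strategies.  A history ρ₀⋯ρₙ ∈ V*V_i is represented as the pair
-- (ρ₀⋯ρ_{n-1} , ρₙ); the value is only constrained when ρₙ ∈ V_i.

record Strategy (A : Arena) (i : Player) : Set where
  field
    σ     : List (V A) → V A → V A
    legal : (w : List (V A)) (v : V A) → owner A v ≡ i → E A v (σ w v) ≡ true

open Strategy public

Consistent : {A : Arena} {i : Player} → Strategy A i → (ℕ → V A) → Set
Consistent {A} {i} s ρ =
  (k : ℕ) → owner A (ρ k) ≡ i → ρ (suc k) ≡ σ s (prefix ρ k) (ρ k)

record MemoryStructure (A : Arena) (m : ℕ) : Set where
  field
    Init : V A → Fin m
    Upd  : Fin m → V A → Fin m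

open MemoryStructure public

Upd⁺ : {A : Arena} {m : ℕ} → MemoryStructure A m → List (V A) → V A → Fin m
Upd⁺ M []      v = Init M v
Upd⁺ M (u ∷ w) v = foldl (Upd M) (Init M u) (w ++ [ v ])

FiniteState : {A : Arena} {i : Player} → Strategy A i → Set
FiniteState {A} {i} s =
  Σ ℕ λ m → Σ (MemoryStructure A m) λ M → Σ (V A → Fin m → V A) λ Nxt →
    ((v : V A) (mem : Fin m) → owner A v ≡ i → E A v (Nxt v mem) ≡ true)
    × ((w : List (V A)) (v : V A) → owner A v ≡ i →
         σ s w v ≡ Nxt v (Upd⁺ M w v))

WinCond : Arena → Set₁
WinCond A = (ℕ → V A) → Set

Wins : {A : Arena} → WinCond A → Player → (ℕ → V A) → Set
Wins Win P0 ρ = Win ρ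
Wins Win P1 ρ = ¬ Win ρ

WinningFrom : (A : Arena) → WinCond A → (i : Player) →
              (V A → Set) → Strategy A i → Set
WinningFrom A Win i W s =
  (ρ : ℕ → V A) → IsPlay A ρ → W (ρ 0) → Consistent {A} s ρ → Wins {A} Win i ρ

data Label : Set where
  ε inc : Label

-- Cost function: a label for every (potential) edge; only values on
-- edges matter.
CostFn : Arena → Set
CostFn A = V A → V A → Label

Coloring : Arena → Set
Coloring A = V A → ℕ

Even : ℕ → Set
Even c = 2 ∣ c

Ans : ℕ → ℕ → Set
Ans c c' = c ≤ c' × Even c'

countInc : Label → ℕ
countInc ε   = 0
countInc inc = 1

costFrom : (A : Arena) → CostFn A → (ℕ → V A) → ℕ → ℕ → ℕ
costFrom A Cst ρ k zero      = 0
costFrom A Cst ρ k (suc len) = countInc (Cst (ρ k) (ρ (suc k))) + costFrom A Cst ρ (suc k) len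

Cost : (A : Arena) → CostFn A → (ℕ → V A) → ℕ → ℕ → ℕ
Cost = costFrom

AnswersAt : (A : Arena) → Coloring A → (ℕ → V A) → ℕ → ℕ → Set
AnswersAt A Ω ρ k k' = k ≤ k' × Ans (Ω (ρ k)) (Ω (ρ k'))

-- Cor(ρ,k) ≤ b   (Cor is a minimum over a set of naturals, so this
-- holds iff some answering position k + len has cost ≤ b)
CorLe : (A : Arena) → Coloring A → CostFn A → (ℕ → V A) → ℕ → ℕ → Set
CorLe A Ω Cst ρ k b =
  ∃ λ len → AnswersAt A Ω ρ k (k + len) × Cost A Cst ρ k len ≤ b

UnansweredInf : (A : Arena) → Coloring A → CostFn A → (ℕ → V A) → ℕ → Set
UnansweredInf A Ω Cst ρ k =
  ((k' : ℕ) → ¬ AnswersAt A Ω ρ k k')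
  × ((m : ℕ) → ∃ λ j → m ≤ j × k ≤ j × Cst (ρ j) (ρ (suc j)) ≡ inc)

-- BndCostParity(Ω, Cst):  limsup_k Cor(ρ,k) < ∞  (i.e. Cor is eventually
-- bounded by some b ∈ ℕ) and no request unanswered with cost ∞.
BndCostParity : (A : Arena) → Coloring A → CostFn A → WinCond A
BndCostParity A Ω Cst ρ =
  (∃ λ b → ∃ λ N → (k : ℕ) → N ≤ k → CorLe A Ω Cst ρ k b)
  × ¬ (∃ λ k → UnansweredInf A Ω Cst ρ k)

Parity : (A : Arena) → Coloring A → WinCond A
Parity A Ω ρ =
  ∃ λ c → Even c
    × ((N : ℕ) → ∃ λ k → N ≤ k × Ω (ρ k) ≡ c)
    × (∃ λ N → (k : ℕ) → N ≤ k → Ω (ρ k) ≤ c)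

CoBuchi : (A : Arena) → (V A → Set) → WinCond A
CoBuchi A I ρ = ∃ λ N → (k : ℕ) → N ≤ k → ¬ I (ρ k)

RR : (A : Arena) → Coloring A → WinCond A
RR A Ω ρ = (k : ℕ) → ∃ λ k' → AnswersAt A Ω ρ k k'

PCRR : (A : Arena) → Coloring A → (V A → Set) → WinCond A
PCRR A Ω I ρ = (Parity A Ω ρ × CoBuchi A I ρ) ⊎ RR A Ω ρ

IncTargets : (A : Arena) → CostFn A → V A → Set
IncTargets A Cst v = ∃ λ u → E A u v ≡ true × Cst u v ≡ inc

NoMixedIncoming : (A : Arena) → CostFn A → Set
NoMixedIncoming A Cst =
  (v u u' : V A) → E A u v ≡ true → E A u' v ≡ true →
  Cst u v ≡ inc → Cst u' v ≡ ε → ⊥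

-- A finite-state strategy sees a play only through the pairs (vertex, memory state). Once such
-- a pair repeats at positions j < j′, repeating ρ_j ⋯ ρ_{j′-1} forever gives another play
-- consistent with the strategy, which the strategy must therefore win as well.
--
-- Player 0. A winning play either satisfies parity and coBüchi(I): then from some point on only
-- ε-edges are taken and the (even) maximal colour seen infinitely often answers every late
-- request at cost 0. Or it satisfies RR: if a request were first answered only after more than
-- |V|·m increment-edges, two targets of these edges would carry the same pair; looping there
-- never answers the request and visits I infinitely often, a play Player 0 loses.
--
-- Player 1. Suppose a consistent play satisfies BndCostParity. From some point on every request is
-- answered, so odd maxima of windows can be raised until every position starts a window with even
-- maximal colour. Chaining such windows and repeating a pair gives a loop with even maximal colour;
-- if it used only ε-edges, its targets would avoid I (no vertex has mixed incoming edges) and the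
-- pumped play would satisfy parity and coBüchi(I), a play Player 1 loses. So increment-edges occur
-- infinitely often, hence no request is unanswered and the play satisfies RR, again lost by Player 1.

module Submission where

open import Defs
open import Data.Nat using (ℕ; zero; suc; z<s; _+_; _*_; _∸_; _≤_; _<_; z≤n; s≤s; _≟_; _≤?_; _<?_)
open import Data.Nat.Properties
open import Data.Nat.Divisibility using (_∣?_)
open import Data.Fin as Fin using (Fin; toℕ; combine)
open import Data.Fin.Properties using (pigeonhole; combine-injective)
open import Data.List using (List; []; _∷_; _∷ʳ_; [_]; map; upTo; length; lookup; tabulate)
open import Data.List.Properties using (foldl-++; upTo-∷ʳ; map-++)
open import Data.List.Relation.Unary.All as All using (All; []; _∷_)
open import Data.List.Relation.Unary.All.Properties using (tabulate⁻)
open import Data.List.Relation.Unary.AllPairs using (AllPairs; []; _∷_)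
open import Data.List.Membership.Propositional.Properties using (∈-lookup)
open import Data.List.Extrema ≤-totalOrder using (max; xs≤max)
open import Data.Product using (∃; ∃₂; Σ; _×_; _,_; proj₁; proj₂)
open import Data.Sum using (_⊎_; inj₁; inj₂)
open import Data.Empty using (⊥; ⊥-elim)
open import Data.Bool using (true)
open import Function using (_∘_)
open import Relation.Nullary using (¬_; Dec; yes; no)
open import Relation.Nullary.Decidable using (_×-dec_)
import Relation.Unary as U
open import Relation.Binary.PropositionalEquality hiding ([_])
open ≡-Reasoning

minimal-witness : {P : ℕ → Set} → U.Decidable P → ∀ {d} → P d →
                  ∃ λ d₀ → P d₀ × (∀ {e} → e < d₀ → ¬ P e)
minimal-witness P? {zero} Pd = zero , Pd , λ ()
minimal-witness P? {suc d} Pd with P? zero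
... | yes P-zero = zero , P-zero , λ ()
... | no ¬P-zero with minimal-witness (P? ∘ suc) Pd
...   | d₀ , Pd₀ , below = suc d₀ , Pd₀ , λ { {zero} _ → ¬P-zero ; {suc e} (s≤s e<d₀) → below e<d₀ }

least-witness-from : {P : ℕ → Set} → U.Decidable P → ∀ {k k′} → k ≤ k′ → P k′ →
                     ∃ λ d → P (k + d) × (∀ {z} → k ≤ z → z < k + d → ¬ P z)
least-witness-from {P} P? {k} k≤k′ Pk′
  with d , Pk+d , none-before ← minimal-witness (P? ∘ (k +_)) (subst P (sym (m+[n∸m]≡n k≤k′)) Pk′)
  = d , Pk+d , none
  where
  none : ∀ {z} → k ≤ z → z < k + d → ¬ P z
  none {z} k≤z z<k+d Pz =
    none-before (+-cancelˡ-< k _ _ (subst (_< k + d) (sym k+[z∸k]≡z) z<k+d)) (subst P (sym k+[z∸k]≡z) Pz)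
    where
    k+[z∸k]≡z : k + (z ∸ k) ≡ z
    k+[z∸k]≡z = m+[n∸m]≡n k≤z

IsMaxIn : (ℕ → ℕ) → ℕ → ℕ → ℕ → Set
IsMaxIn g a b p = a ≤ p × p < b × (∀ {z} → a ≤ z → z < b → g z ≤ g p)

argmax-in : ∀ g {a b} → a < b → ∃ (IsMaxIn g a b)
argmax-in g {a} {suc b} (s≤s a≤b) with m≤n⇒m<n∨m≡n a≤b
... | inj₂ refl = a , ≤-refl , ≤-refl , λ a≤z z<1+a → ≤-reflexive (cong g (≤-antisym (≤-pred z<1+a) a≤z))
... | inj₁ a<b with argmax-in g a<b
...   | p , a≤p , p<b , p-max with g p ≤? g b
...     | yes gp≤gb = b , a≤b , ≤-refl , b-max
  where
  b-max : ∀ {z} → a ≤ z → z < suc b → g z ≤ g b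
  b-max a≤z z<1+b with m<1+n⇒m<n∨m≡n z<1+b
  ... | inj₁ z<b = ≤-trans (p-max a≤z z<b) gp≤gb
  ... | inj₂ refl = ≤-refl
...     | no gp≰gb = p , a≤p , m<n⇒m<1+n p<b , p-max′
  where
  p-max′ : ∀ {z} → a ≤ z → z < suc b → g z ≤ g p
  p-max′ a≤z z<1+b with m<1+n⇒m<n∨m≡n z<1+b
  ... | inj₁ z<b = p-max a≤z z<b
  ... | inj₂ refl = <⇒≤ (≰⇒> gp≰gb)

EvenMaxIn : (ℕ → ℕ) → ℕ → ℕ → Set
EvenMaxIn g a b = ∃ λ p → IsMaxIn g a b p × Even (g p)

EvenMaxIn⇒< : ∀ {g a b} → EvenMaxIn g a b → a < b
EvenMaxIn⇒< (_ , (a≤p , p<b , _) , _) = ≤-<-trans a≤p p<b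

EvenMaxIn-++ : ∀ {g a b c} → EvenMaxIn g a b → EvenMaxIn g b c → EvenMaxIn g a c
EvenMaxIn-++ {g} {a} {b} {c} (p , (a≤p , p<b , p-max) , even-p) (q , (b≤q , q<c , q-max) , even-q)
  with g p ≤? g q
... | yes gp≤gq = q , (≤-trans (≤-trans a≤p (<⇒≤ p<b)) b≤q , q<c , q-max′) , even-q
  where
  q-max′ : ∀ {z} → a ≤ z → z < c → g z ≤ g q
  q-max′ {z} a≤z z<c with z <? b
  ... | yes z<b = ≤-trans (p-max a≤z z<b) gp≤gq
  ... | no z≮b = q-max (≮⇒≥ z≮b) z<c
... | no gp≰gq = p , (a≤p , <-≤-trans p<b (≤-trans b≤q (<⇒≤ q<c)) , p-max′) , even-p
  where
  p-max′ : ∀ {z} → a ≤ z → z < c → g z ≤ g p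
  p-max′ {z} a≤z z<c with z <? b
  ... | yes z<b = p-max a≤z z<b
  ... | no z≮b = ≤-trans (q-max (≮⇒≥ z≮b) z<c) (<⇒≤ (≰⇒> gp≰gq))

lookup-AllPairs : ∀ {R : ℕ → ℕ → Set} {xs} → AllPairs R xs →
                  ∀ {i j : Fin (length xs)} → i Fin.< j → R (lookup xs i) (lookup xs j)
lookup-AllPairs (x<xs ∷ _) {Fin.zero} {Fin.suc j} _ = All.lookup x<xs (∈-lookup j)
lookup-AllPairs (_ ∷ pairs) {Fin.suc i} {Fin.suc j} (s≤s i<j) = lookup-AllPairs pairs i<j

pigeonhole-sorted : ∀ {K} (key : ℕ → Fin K) {P : ℕ → Set} {xs : List ℕ} →
                    AllPairs _<_ xs → All P xs → K < length xs →
                    ∃₂ λ a b → a < b × P a × P b × key a ≡ key b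
pigeonhole-sorted key {xs = xs} sorted all K<len
  with i , j , i<j , same ← pigeonhole K<len (key ∘ lookup xs)
  = lookup xs i , lookup xs j , lookup-AllPairs sorted i<j ,
    All.lookup all (∈-lookup i) , All.lookup all (∈-lookup j) , same

pigeonhole-ℕ : ∀ {K} (key : ℕ → Fin K) → ∃₂ λ s t → s < t × key s ≡ key t
pigeonhole-ℕ {K} key with i , j , i<j , same ← pigeonhole (n<1+n K) (key ∘ toℕ) = toℕ i , toℕ j , i<j , same

¬¬-∀-from-eventually : ∀ {P : ℕ → Set} N → (∀ {k} → N ≤ k → P k) → (∀ k → ¬ ¬ P k) → ¬ ¬ (∀ k → P k)
¬¬-∀-from-eventually zero    eventually _   ¬all = ¬all λ _ → eventually z≤n
¬¬-∀-from-eventually {P} (suc N) eventually ¬¬P ¬all =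
  ¬¬P N λ PN → ¬¬-∀-from-eventually N (from-N PN) ¬¬P ¬all
  where
  from-N : P N → ∀ {k} → N ≤ k → P k
  from-N PN N≤k with m≤n⇒m<n∨m≡n N≤k
  ... | inj₁ N<k = eventually N<k
  ... | inj₂ refl = PN

Upd⁺-∷ʳ : ∀ {A m} (M : MemoryStructure A m) w (v v′ : V A) →
          Upd⁺ M (w ∷ʳ v) v′ ≡ Upd M (Upd⁺ M w v) v′
Upd⁺-∷ʳ M []      v v′ = refl
Upd⁺-∷ʳ M (u ∷ w) v v′ = foldl-++ (Upd M) (Init M u) (w ∷ʳ v) [ v′ ]

prefix-suc : ∀ {X : Set} (ρ : ℕ → X) k → prefix ρ (suc k) ≡ prefix ρ k ∷ʳ ρ k
prefix-suc ρ k = trans (cong (map ρ) (sym (upTo-∷ʳ k))) (map-++ ρ (upTo k) [ k ])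

memory : ∀ {A m} → MemoryStructure A m → (ℕ → V A) → ℕ → Fin m
memory M ρ k = Upd⁺ M (prefix ρ k) (ρ k)

memory-suc : ∀ {A m} (M : MemoryStructure A m) ρ k →
             memory M ρ (suc k) ≡ Upd M (memory M ρ k) (ρ (suc k))
memory-suc M ρ k = begin
  Upd⁺ M (prefix ρ (suc k)) (ρ (suc k))  ≡⟨ cong (λ w → Upd⁺ M w (ρ (suc k))) (prefix-suc ρ k) ⟩
  Upd⁺ M (prefix ρ k ∷ʳ ρ k) (ρ (suc k)) ≡⟨ Upd⁺-∷ʳ M (prefix ρ k) (ρ k) (ρ (suc k)) ⟩
  Upd M (memory M ρ k) (ρ (suc k))       ∎

-- The pair (vertex, memory state), encoded in Fin (|V| · m) for the pigeonhole principle.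
state : ∀ {A m} → MemoryStructure A m → (ℕ → V A) → ℕ → Fin (n A * m)
state M ρ k = combine (ρ k) (memory M ρ k)

-- The pumped play is ρ ∘ index with index = 0, 1, …, j′-1, j, …, j′-1, j, …
module Pumping {A : Arena} {i : Player} (s : Strategy A i) {m : ℕ}
  (M : MemoryStructure A m) (Nxt : V A → Fin m → V A)
  (implements : ∀ w v → owner A v ≡ i → σ s w v ≡ Nxt v (Upd⁺ M w v))
  {ρ : ℕ → V A} (play : IsPlay A ρ) (consistent : Consistent s ρ)
  {j j′ : ℕ} (j<j′ : j < j′) (same-state : state M ρ j ≡ state M ρ j′)
  where

  same-vertex : ρ j ≡ ρ j′
  same-vertex = proj₁ (combine-injective (ρ j) (memory M ρ j) (ρ j′) (memory M ρ j′) same-state)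

  same-memory : memory M ρ j ≡ memory M ρ j′
  same-memory = proj₂ (combine-injective (ρ j) (memory M ρ j) (ρ j′) (memory M ρ j′) same-state)

  step : ℕ → ℕ
  step x with suc x ≟ j′
  ... | yes _ = j
  ... | no  _ = suc x

  index : ℕ → ℕ
  index zero    = zero
  index (suc p) = step (index p)

  pumped : ℕ → V A
  pumped p = ρ (index p)

  ρ-step : ∀ x → ρ (step x) ≡ ρ (suc x)
  ρ-step x with suc x ≟ j′
  ... | yes 1+x≡j′ = trans same-vertex (cong ρ (sym 1+x≡j′))
  ... | no  _      = refl

  memory-step : ∀ x → memory M ρ (step x) ≡ Upd M (memory M ρ x) (ρ (step x))
  memory-step x with suc x ≟ j′
  ... | yes 1+x≡j′ = begin
    memory M ρ j                       ≡⟨ same-memory ⟩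
    memory M ρ j′                      ≡⟨ cong (memory M ρ) (sym 1+x≡j′) ⟩
    memory M ρ (suc x)                 ≡⟨ memory-suc M ρ x ⟩
    Upd M (memory M ρ x) (ρ (suc x))   ≡⟨ cong (Upd M (memory M ρ x)) (trans (cong ρ 1+x≡j′) (sym same-vertex)) ⟩
    Upd M (memory M ρ x) (ρ j)         ∎
  ... | no  _      = memory-suc M ρ x

  pumped-isPlay : IsPlay A pumped
  pumped-isPlay p = subst (λ v → E A (pumped p) v ≡ true) (sym (ρ-step (index p))) (play (index p))

  memory-pumped : ∀ p → memory M pumped p ≡ memory M ρ (index p)
  memory-pumped zero    = refl
  memory-pumped (suc p) = begin
    memory M pumped (suc p)                      ≡⟨ memory-suc M pumped p ⟩
    Upd M (memory M pumped p) (pumped (suc p))   ≡⟨ cong (λ μ → Upd M μ (pumped (suc p))) (memory-pumped p) ⟩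
    Upd M (memory M ρ (index p)) (pumped (suc p)) ≡⟨ memory-step (index p) ⟨
    memory M ρ (index (suc p))                   ∎

  pumped-consistent : Consistent s pumped
  pumped-consistent p owned = begin
    pumped (suc p)                          ≡⟨ ρ-step (index p) ⟩
    ρ (suc (index p))                       ≡⟨ consistent (index p) owned ⟩
    σ s (prefix ρ (index p)) (pumped p)     ≡⟨ implements _ _ owned ⟩
    Nxt (pumped p) (memory M ρ (index p))   ≡⟨ cong (Nxt (pumped p)) (memory-pumped p) ⟨
    Nxt (pumped p) (memory M pumped p)      ≡⟨ implements _ _ owned ⟨
    σ s (prefix pumped p) (pumped p)        ∎

  step-advances : ∀ {x} → suc x ≢ j′ → step x ≡ suc x
  step-advances {x} 1+x≢j′ with suc x ≟ j′
  ... | yes 1+x≡j′ = ⊥-elim (1+x≢j′ 1+x≡j′)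
  ... | no  _      = refl

  step-wraps : ∀ {x} → suc x ≡ j′ → step x ≡ j
  step-wraps {x} 1+x≡j′ with suc x ≟ j′
  ... | yes _      = refl
  ... | no 1+x≢j′ = ⊥-elim (1+x≢j′ 1+x≡j′)

  index-bound : ∀ p → index p < j′
  index-bound zero    = ≤-<-trans z≤n j<j′
  index-bound (suc p) with suc (index p) ≟ j′
  ... | yes _       = j<j′
  ... | no  1+i≢j′ = ≤∧≢⇒< (index-bound p) 1+i≢j′

  index-below : ∀ {p} → p < j′ → index p ≡ p
  index-below {zero}  _       = refl
  index-below {suc p} 1+p<j′ = begin
    step (index p) ≡⟨ cong step (index-below (<-trans (n<1+n p) 1+p<j′)) ⟩
    step p         ≡⟨ step-advances (<⇒≢ 1+p<j′) ⟩
    suc p          ∎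

  index-identity-or-loop : ∀ p → index p ≡ p ⊎ j ≤ index p
  index-identity-or-loop zero = inj₁ refl
  index-identity-or-loop (suc p) with suc (index p) ≟ j′ | index-identity-or-loop p
  ... | yes _ | _        = inj₂ ≤-refl
  ... | no  _ | inj₁ i≡p = inj₁ (cong suc i≡p)
  ... | no  _ | inj₂ j≤i = inj₂ (m≤n⇒m≤1+n j≤i)

  index-from : ∀ {k p} → k ≤ j → k ≤ p → k ≤ index p
  index-from {p = p} k≤j k≤p with index-identity-or-loop p
  ... | inj₁ i≡p = subst (_ ≤_) (sym i≡p) k≤p
  ... | inj₂ j≤i = ≤-trans k≤j j≤i

  index-walk : ∀ d p → index p + d < j′ → index (p + d) ≡ index p + d
  index-walk zero    p _ = trans (cong index (+-identityʳ p)) (sym (+-identityʳ (index p)))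
  index-walk (suc d) p i+1+d<j′ = begin
    index (p + suc d)     ≡⟨ cong index (+-suc p d) ⟩
    step (index (p + d))  ≡⟨ cong step (index-walk d p (<⇒≤ 1+i+d<j′)) ⟩
    step (index p + d)    ≡⟨ step-advances (<⇒≢ 1+i+d<j′) ⟩
    suc (index p + d)     ≡⟨ +-suc (index p) d ⟨
    index p + suc d       ∎
    where
    1+i+d<j′ : suc (index p + d) < j′
    1+i+d<j′ = subst (_< j′) (+-suc (index p) d) i+1+d<j′

  index-returns : ∀ N → ∃ λ q → N ≤ q × index q ≡ j
  index-returns N = suc (N + d) , m≤n⇒m≤1+n (m≤m+n N d) , step-wraps 1+i≡j′
    where
    d = j′ ∸ suc (index N)
    1+iN+d≡j′ : suc (index N) + d ≡ j′
    1+iN+d≡j′ = m+[n∸m]≡n (index-bound N)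
    1+i≡j′ : suc (index (N + d)) ≡ j′
    1+i≡j′ = trans (cong suc (index-walk d N (≤-reflexive 1+iN+d≡j′))) 1+iN+d≡j′

  index-hits : ∀ N {y} → j ≤ y → y < j′ → ∃ λ q → N ≤ q × index q ≡ y
  index-hits N {y} j≤y y<j′ with q , N≤q , iq≡j ← index-returns N =
    q + (y ∸ j) , ≤-trans N≤q (m≤m+n q _) , trans (index-walk (y ∸ j) q iq+d<j′) iq+d≡y
    where
    iq+d≡y : index q + (y ∸ j) ≡ y
    iq+d≡y = trans (cong (_+ (y ∸ j)) iq≡j) (m+[n∸m]≡n j≤y)
    iq+d<j′ : index q + (y ∸ j) < j′
    iq+d<j′ = subst (_< j′) (sym iq+d≡y) y<j′

  module _ (Ω : Coloring A) (Cst : CostFn A) where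

    pumped-∉-PCRR : ∀ {k} → k ≤ j → (∀ {z} → k ≤ z → z < j′ → ¬ Ans (Ω (ρ k)) (Ω (ρ z))) →
                    IncTargets A Cst (ρ j) → ¬ PCRR A Ω (IncTargets A Cst) pumped
    pumped-∉-PCRR _ _ j∈I (inj₁ (_ , N , avoids-I))
      with q , N≤q , iq≡j ← index-hits N ≤-refl j<j′ =
      avoids-I q N≤q (subst (IncTargets A Cst ∘ ρ) (sym iq≡j) j∈I)
    pumped-∉-PCRR {k} k≤j unanswered _ (inj₂ rr)
      with k′ , k≤k′ , answer ← rr k =
      unanswered (index-from k≤j k≤k′) (index-bound k′)
        (subst (λ v → Ans (Ω v) (Ω (pumped k′))) (cong ρ (index-below (≤-<-trans k≤j j<j′))) answer)

    pumped-∈-PCRR : NoMixedIncoming A Cst → EvenMaxIn (Ω ∘ ρ) j j′ →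
                    (∀ {e} → j ≤ e → e < j′ → Cst (ρ e) (ρ (suc e)) ≡ ε) →
                    PCRR A Ω (IncTargets A Cst) pumped
    pumped-∈-PCRR no-mixed (x , (j≤x , x<j′ , x-max) , even-x) loop-ε = inj₁ (parity , suc j , avoids-I)
      where
      parity : Parity A Ω pumped
      parity = Ω (ρ x) , even-x ,
               (λ N → let q , N≤q , iq≡x = index-hits N j≤x x<j′ in q , N≤q , cong (Ω ∘ ρ) iq≡x) ,
               j , λ k j≤k → x-max (index-from ≤-refl j≤k) (index-bound k)
      avoids-I : ∀ p → suc j ≤ p → ¬ IncTargets A Cst (pumped p)
      avoids-I (suc p) (s≤s j≤p) (u , edge , increment) =
        no-mixed (pumped (suc p)) u (pumped p) edge (pumped-isPlay p) increment
          (trans (cong (Cst (pumped p)) (ρ-step (index p))) (loop-ε (index-from ≤-refl j≤p) (index-bound p)))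

inc? : ∀ l → Dec (l ≡ inc)
inc? ε   = no λ ()
inc? inc = yes refl

≢inc⇒≡ε : ∀ {l} → l ≢ inc → l ≡ ε
≢inc⇒≡ε {ε}   _       = refl
≢inc⇒≡ε {inc} l≢inc = ⊥-elim (l≢inc refl)

ans? : ∀ c c′ → Dec (Ans c c′)
ans? c c′ = (c ≤? c′) ×-dec (2 ∣? c′)

module Increments {A : Arena} (Cst : CostFn A) (ρ : ℕ → V A) where

  label : ℕ → Label
  label e = Cst (ρ e) (ρ (suc e))

  IncrementIn : ℕ → ℕ → ℕ → Set
  IncrementIn k len e = k ≤ e × e < k + len × label e ≡ inc

  increments : ℕ → ℕ → List ℕ
  increments k zero      = []
  increments k (suc len) with label k
  ... | ε   = increments (suc k) len
  ... | inc = k ∷ increments (suc k) len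

  increments-length : ∀ k len → length (increments k len) ≡ Cost A Cst ρ k len
  increments-length k zero      = refl
  increments-length k (suc len) with label k
  ... | ε   = increments-length (suc k) len
  ... | inc = cong suc (increments-length (suc k) len)

  IncrementIn-suc : ∀ {k len e} → IncrementIn (suc k) len e → IncrementIn k (suc len) e
  IncrementIn-suc {k} {len} {e} (k<e , e<1+k+len , increment) =
    <⇒≤ k<e , subst (e <_) (sym (+-suc k len)) e<1+k+len , increment

  increments-in : ∀ k len → All (IncrementIn k len) (increments k len)
  increments-in k zero      = []
  increments-in k (suc len) with label k in lk
  ... | ε   = All.map IncrementIn-suc (increments-in (suc k) len)
  ... | inc = (≤-refl , m<m+n k z<s , lk) ∷ All.map IncrementIn-suc (increments-in (suc k) len)

  increments-sorted : ∀ k len → AllPairs _<_ (increments k len)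
  increments-sorted k zero      = []
  increments-sorted k (suc len) with label k
  ... | ε   = increments-sorted (suc k) len
  ... | inc = All.map proj₁ (increments-in (suc k) len) ∷ increments-sorted (suc k) len

  repeated-key-at-increments : ∀ {K} (key : ℕ → Fin K) {k len} → K < Cost A Cst ρ k len →
    ∃₂ λ e₁ e₂ → e₁ < e₂ × IncrementIn k len e₁ × IncrementIn k len e₂ × key e₁ ≡ key e₂
  repeated-key-at-increments key {k} {len} K<cost =
    pigeonhole-sorted key (increments-sorted k len) (increments-in k len)
      (subst (_ <_) (sym (increments-length k len)) K<cost)

  increment-or-ε : ∀ a b → (∃ λ e → a ≤ e × e < b × label e ≡ inc) ⊎ (∀ {e} → a ≤ e → e < b → label e ≡ ε)
  increment-or-ε a b with anyUpTo? (λ e → (a ≤? e) ×-dec inc? (label e)) b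
  ... | yes (e , e<b , a≤e , increment) = inj₁ (e , a≤e , e<b , increment)
  ... | no  none = inj₂ λ a≤e e<b → ≢inc⇒≡ε λ increment → none (_ , e<b , a≤e , increment)

  eventually-ε : IsPlay A ρ → CoBuchi A (IncTargets A Cst) ρ → ∃ λ N → ∀ {e} → N ≤ e → label e ≡ ε
  eventually-ε play (N , avoids-I) =
    N , λ {e} N≤e → ≢inc⇒≡ε λ increment → avoids-I (suc e) (m≤n⇒m≤1+n N≤e) (ρ e , play e , increment)

  cost-ε : ∀ {N} → (∀ {e} → N ≤ e → label e ≡ ε) → ∀ {k} len → N ≤ k → Cost A Cst ρ k len ≡ 0
  cost-ε all-ε zero      _   = refl
  cost-ε all-ε (suc len) N≤k rewrite all-ε N≤k = cost-ε all-ε len (m≤n⇒m≤1+n N≤k)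

parity∩coBüchi⇒bndCostParity : ∀ {A Ω Cst ρ} → IsPlay A ρ → Parity A Ω ρ →
  CoBuchi A (IncTargets A Cst) ρ → BndCostParity A Ω Cst ρ
parity∩coBüchi⇒bndCostParity {A} {Ω} {Cst} {ρ} play (c , even-c , c-often , N₂ , c-max) coBüchi
  with N₁ , all-ε ← Increments.eventually-ε {A} Cst ρ play coBüchi =
  (0 , N₁ + N₂ , answered-free) , λ (_ , _ , increments-after) → no-increment-after (increments-after N₁)
  where
  open Increments {A} Cst ρ
  answered-free : ∀ k → N₁ + N₂ ≤ k → CorLe A Ω Cst ρ k 0
  answered-free k N≤k with q , k≤q , cq≡c ← c-often k =
    q ∸ k , (m≤m+n k _ , answer) , ≤-reflexive (cost-ε all-ε (q ∸ k) (≤-trans (m≤m+n N₁ N₂) N≤k))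
    where
    answer : Ans (Ω (ρ k)) (Ω (ρ (k + (q ∸ k))))
    answer rewrite m+[n∸m]≡n k≤q | cq≡c = c-max k (≤-trans (m≤n+m N₂ N₁) N≤k) , even-c
  no-increment-after : ∀ {k} → ¬ (∃ λ e → N₁ ≤ e × k ≤ e × label e ≡ inc)
  no-increment-after (e , N₁≤e , _ , increment) with () ← trans (sym increment) (all-ε N₁≤e)

module Player0 {A : Arena} (Cst : CostFn A) (Ω : Coloring A)
  (s : Strategy A P0) {m : ℕ} (M : MemoryStructure A m) (Nxt : V A → Fin m → V A)
  (implements : ∀ w v → owner A v ≡ P0 → σ s w v ≡ Nxt v (Upd⁺ M w v))
  (W : V A → Set) (win : WinningFrom A (PCRR A Ω (IncTargets A Cst)) P0 W s)
  {ρ : ℕ → V A} (play : IsPlay A ρ) (start : W (ρ 0)) (consistent : Consistent s ρ)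
  where

  open Increments {A} Cst ρ

  colour : ℕ → ℕ
  colour k = Ω (ρ k)

  no-unanswered-loop : ∀ {k j j′} (j<j′ : j < j′) → state M ρ j ≡ state M ρ j′ → k ≤ j →
    (∀ {z} → k ≤ z → z < j′ → ¬ Ans (colour k) (colour z)) → ¬ IncTargets A Cst (ρ j)
  no-unanswered-loop j<j′ same k≤j unanswered j∈I =
    P.pumped-∉-PCRR Ω Cst k≤j unanswered j∈I (win P.pumped P.pumped-isPlay start P.pumped-consistent)
    where module P = Pumping s M Nxt implements play consistent j<j′ same

  cost-before-answer : ∀ {k d} → (∀ {z} → k ≤ z → z < k + d → ¬ Ans (colour k) (colour z)) →
                       Cost A Cst ρ k d ≤ n A * m
  cost-before-answer {k} unanswered = ≮⇒≥ λ expensive →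
    let e₁ , e₂ , e₁<e₂ , (k≤e₁ , _ , increment) , (_ , e₂<k+d , _) , same =
          repeated-key-at-increments (state M ρ ∘ suc) expensive
    in no-unanswered-loop (s≤s e₁<e₂) same (m≤n⇒m≤1+n k≤e₁)
         (λ k≤z z<1+e₂ → unanswered k≤z (≤-<-trans (≤-pred z<1+e₂) e₂<k+d))
         (ρ e₁ , play e₁ , increment)

  answered-cheaply : RR A Ω ρ → ∀ k → CorLe A Ω Cst ρ k (n A * m)
  answered-cheaply rr k with k′ , k≤k′ , answer ← rr k
    with d , first-answer , none-before ← least-witness-from (λ z → ans? (colour k) (colour z)) k≤k′ answer =
    d , (m≤m+n k d , first-answer) , cost-before-answer none-before

  bndCostParity : BndCostParity A Ω Cst ρ
  bndCostParity with win ρ play start consistent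
  ... | inj₁ (parity , coBüchi) = parity∩coBüchi⇒bndCostParity {Ω = Ω} play parity coBüchi
  ... | inj₂ rr = (n A * m , 0 , λ k _ → answered-cheaply rr k) ,
                  λ (k , never-answered , _) → never-answered (proj₁ (rr k)) (proj₂ (rr k))

module Player1 {A : Arena} (Cst : CostFn A) (Ω : Coloring A) (no-mixed : NoMixedIncoming A Cst)
  (s : Strategy A P1) {m : ℕ} (M : MemoryStructure A m) (Nxt : V A → Fin m → V A)
  (implements : ∀ w v → owner A v ≡ P1 → σ s w v ≡ Nxt v (Upd⁺ M w v))
  (W : V A → Set) (win : WinningFrom A (PCRR A Ω (IncTargets A Cst)) P1 W s)
  {ρ : ℕ → V A} (play : IsPlay A ρ) (start : W (ρ 0)) (consistent : Consistent s ρ)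
  (bounded : BndCostParity A Ω Cst ρ)
  where

  open Increments {A} Cst ρ

  colour : ℕ → ℕ
  colour k = Ω (ρ k)

  no-even-ε-loop : ∀ {j j′} → state M ρ j ≡ state M ρ j′ → EvenMaxIn colour j j′ →
                   ¬ (∀ {e} → j ≤ e → e < j′ → label e ≡ ε)
  no-even-ε-loop same even-max loop-ε =
    win P.pumped P.pumped-isPlay start P.pumped-consistent (P.pumped-∈-PCRR Ω Cst no-mixed even-max loop-ε)
    where module P = Pumping s M Nxt implements play consistent (EvenMaxIn⇒< even-max) same

  N : ℕ
  N = proj₁ (proj₂ (proj₁ bounded))

  answered-late : ∀ {k} → N ≤ k → ∃ (AnswersAt A Ω ρ k)
  answered-late {k} N≤k with len , answer , _ ← proj₂ (proj₂ (proj₁ bounded)) k N≤k = k + len , answer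

  C : ℕ
  C = max 0 (tabulate Ω)

  colour≤C : ∀ k → colour k ≤ C
  colour≤C k = tabulate⁻ (xs≤max 0 (tabulate Ω)) (ρ k)

  larger-max : ∀ {x p} → N ≤ x → x ≤ p → ¬ Even (colour p) →
               ∃₂ λ y p′ → IsMaxIn colour x y p′ × colour p < colour p′
  larger-max {x} {p} N≤x x≤p odd with q , p≤q , cp≤cq , even-q ← answered-late (≤-trans N≤x x≤p)
    with p′ , p′-max@(_ , _ , below-p′) ← argmax-in colour (s≤s (≤-trans x≤p p≤q)) =
    suc q , p′ , p′-max ,
    <-≤-trans (≤∧≢⇒< cp≤cq λ cp≡cq → odd (subst Even (sym cp≡cq) even-q)) (below-p′ (≤-trans x≤p p≤q) ≤-refl)

  climb : ∀ F {x y p} → N ≤ x → IsMaxIn colour x y p → C < F + colour p → ∃ (EvenMaxIn colour x)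
  climb F {y = y} {p} N≤x p-max C< with 2 ∣? colour p
  ... | yes even = y , p , p-max , even
  climb zero    {p = p} N≤x p-max C< | no odd = ⊥-elim (<⇒≱ C< (colour≤C p))
  climb (suc F) {p = p} N≤x p-max C< | no odd
    with _ , p′ , p′-max , cp<cp′ ← larger-max N≤x (proj₁ p-max) odd =
    climb F N≤x p′-max (<-≤-trans C< (subst (_≤ F + colour p′) (+-suc F (colour p)) (+-monoʳ-≤ F cp<cp′)))

  even-max-from : ∀ {x} → N ≤ x → ∃ (EvenMaxIn colour x)
  even-max-from {x} N≤x with p , p-max ← argmax-in colour (n<1+n x) =
    climb (suc C) N≤x p-max (s≤s (m≤m+n C (colour p)))

  module Blocks {base : ℕ} (N≤base : N ≤ base) where

    boundary : ℕ → Σ ℕ (N ≤_)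
    boundary zero    = base , N≤base
    boundary (suc t) with x , N≤x ← boundary t =
      proj₁ (even-max-from N≤x) , ≤-trans N≤x (<⇒≤ (EvenMaxIn⇒< (proj₂ (even-max-from N≤x))))

    blocks : ℕ → ℕ
    blocks t = proj₁ (boundary t)

    block-even : ∀ t → EvenMaxIn colour (blocks t) (blocks (suc t))
    block-even t = proj₂ (even-max-from (proj₂ (boundary t)))

    blocks-even : ∀ {s t} → s < t → EvenMaxIn colour (blocks s) (blocks t)
    blocks-even {s} {suc t} s<1+t with m<1+n⇒m<n∨m≡n s<1+t
    ... | inj₁ s<t  = EvenMaxIn-++ (blocks-even s<t) (block-even t)
    ... | inj₂ refl = block-even t

    blocks-from : ∀ t → base ≤ blocks t
    blocks-from zero    = ≤-refl
    blocks-from (suc t) = ≤-trans (blocks-from t) (<⇒≤ (EvenMaxIn⇒< (block-even t)))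

    even-loop : ∃₂ λ j j′ → base ≤ j × state M ρ j ≡ state M ρ j′ × EvenMaxIn colour j j′
    even-loop with s , t , s<t , same ← pigeonhole-ℕ (state M ρ ∘ blocks) =
      blocks s , blocks t , blocks-from s , same , blocks-even s<t

  increment-after : ∀ m₀ → ∃ λ e → m₀ ≤ e × label e ≡ inc
  increment-after m₀ with Blocks.even-loop (m≤n+m N m₀)
  ... | j , j′ , m₀+N≤j , same , even-max with increment-or-ε j j′
  ...   | inj₁ (e , j≤e , _ , increment) = e , ≤-trans (m≤m+n m₀ N) (≤-trans m₀+N≤j j≤e) , increment
  ...   | inj₂ loop-ε = ⊥-elim (no-even-ε-loop same even-max loop-ε)

  -- BndCostParity only refutes unanswered requests, so constructively we get RR only doubly negated.
  every-request-answered : ¬ ¬ RR A Ω ρ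
  every-request-answered = ¬¬-∀-from-eventually N answered-late answered
    where
    answered : ∀ k → ¬ ¬ ∃ (AnswersAt A Ω ρ k)
    answered k unanswered = proj₂ bounded (k , (λ k′ answer → unanswered (k′ , answer)) , λ m₀ →
      let e , m₀+k≤e , increment = increment-after (m₀ + k)
      in e , ≤-trans (m≤m+n m₀ k) m₀+k≤e , ≤-trans (m≤n+m k m₀) m₀+k≤e , increment)

  absurd : ⊥
  absurd = every-request-answered λ rr → win ρ play start consistent (inj₂ rr)

lemma3p1 : (A : Arena) (Cst : CostFn A) (Ω : Coloring A) →
    NoMixedIncoming A Cst →
    (i : Player) (W : V A → Set) (s : Strategy A i) →
    FiniteState s →
    WinningFrom A (PCRR A Ω (IncTargets A Cst)) i W s →
    WinningFrom A (BndCostParity A Ω Cst) i W s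
lemma3p1 A Cst Ω no-mixed P0 W s (_ , M , Nxt , _ , implements) win ρ play start consistent =
  Player0.bndCostParity Cst Ω s M Nxt implements W win play start consistent
lemma3p1 A Cst Ω no-mixed P1 W s (_ , M , Nxt , _ , implements) win ρ play start consistent bounded =
  Player1.absurd Cst Ω no-mixed s M Nxt implements W win play start consistent bounded
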